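{- Let $\Phi=(G,\varphi)$ be a $\mathbb{T}$-gain graph on a complete bipartite graph $G$. If there is a vertex $v$ of $G$ such that every $4$-cycle passing through $v$ has gain $1$, then $\Phi$ is balanced.
   Context: A $\mathbb{T}$-gain graph $\Phi=(G,\varphi)$ consists of a finite simple graph $G$ and a map $\varphi$ assigning to each orientation $\overrightarrow{e_{p,q}}$ of each edge $v_pv_q$ a value in $\mathbb{T}=\{z\in\mathbb{C}:|z|=1\}$, with $\varphi(\overrightarrow{e_{q,p}})=\varphi(\overrightarrow{e_{p,q}})^{ -1}$. The gain of an oriented cycle is the product of the gains of its oriented edges; a cycle has gain $1$ if both of its orientations have gain $1$. $\Phi$ is balanced if every oriented cycle has gain $1$. -}

module Defs where

open import Level using (Level)
open import Data.Nat using (ℕ; _≤_)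
open import Data.Fin using (Fin)
open import Data.Sum using (_⊎_; inj₁; inj₂)
open import Data.Unit using (⊤)
open import Data.Empty using (⊥)
open import Data.Product using (_×_)
open import Data.List using (List; []; _∷_; _++_; [_]; length)
open import Data.List.Relation.Unary.Linked using (Linked)
open import Data.List.Relation.Unary.Unique.Propositional using (Unique)
open import Algebra.Bundles using (AbelianGroup)

Vertex : ℕ → ℕ → Set
Vertex m n = Fin m ⊎ Fin n

Adj : ∀ {m n} → Vertex m n → Vertex m n → Set
Adj (inj₁ _) (inj₂ _) = ⊤
Adj (inj₂ _) (inj₁ _) = ⊤
Adj (inj₁ _) (inj₁ _) = ⊥
Adj (inj₂ _) (inj₂ _) = ⊥

-- A cycle of K_{m,n}, given by its cyclic vertex sequence x₀ x₁ … x_{k-1}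
-- (an oriented cycle with a chosen starting vertex): at least 3 vertices,
-- pairwise distinct, consecutive ones (including x_{k-1}, x₀) adjacent.
IsCycle : ∀ {m n} → List (Vertex m n) → Set
IsCycle [] = ⊥
IsCycle (x ∷ xs) = (3 ≤ length (x ∷ xs)) × Unique (x ∷ xs) × Linked Adj ((x ∷ xs) ++ [ x ])

module GainGraph {c ℓ : Level} (T : AbelianGroup c ℓ) where
  open AbelianGroup T

  -- A gain function on K_{m,n} is determined by the gains φ a b of the
  -- orientations (left a → right b); the reverse orientation gets φ a b ⁻¹.
  GainFn : ℕ → ℕ → Set c
  GainFn m n = Fin m → Fin n → Carrier

  -- gain of the oriented edge u → w (value on non-edges is irrelevant)
  edgeGain : ∀ {m n} → GainFn m n → Vertex m n → Vertex m n → Carrier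
  edgeGain φ (inj₁ a) (inj₂ b) = φ a b
  edgeGain φ (inj₂ b) (inj₁ a) = φ a b ⁻¹
  edgeGain φ _ _ = ε

  walkGain : ∀ {m n} → GainFn m n → List (Vertex m n) → Carrier
  walkGain φ [] = ε
  walkGain φ (x ∷ []) = ε
  walkGain φ (x ∷ y ∷ ys) = edgeGain φ x y ∙ walkGain φ (y ∷ ys)

  cycleGain : ∀ {m n} → GainFn m n → List (Vertex m n) → Carrier
  cycleGain φ [] = ε
  cycleGain φ (x ∷ xs) = walkGain φ ((x ∷ xs) ++ [ x ])

  Balanced : ∀ {m n} → GainFn m n → Set ℓ
  Balanced {m} {n} φ = (cs : List (Vertex m n)) → IsCycle cs → cycleGain φ cs ≈ ε

-- A balanced gain graph is one admitting a potential p on the vertices with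
-- p x ∙ φ(x → y) = p y along every edge: the gain of a closed walk then
-- telescopes to 1. Rooting the potential at v, set p w to the gain of a
-- path of length at most 2 from v to w (through a fixed neighbour of v).
-- The edge condition at an edge x y not containing v says precisely that
-- the closed walk v → … → x → y → … → v of length 4 has gain 1; this walk
-- is either a 4-cycle through v or backtracks, in which case its gain is 1
-- trivially.
module Submission where

open import Defs
open import Data.Nat using (ℕ; zero; suc; s≤s; z≤n)
open import Data.List using (List; length; []; _∷_; _++_; [_])
open import Data.List.Membership.Propositional using (_∈_)
open import Data.List.Relation.Unary.Any using (here)
open import Data.List.Relation.Unary.All using ([]; _∷_)
open import Data.List.Relation.Unary.AllPairs using ([]; _∷_)
open import Data.List.Relation.Unary.Linked using (Linked; [-]; _∷_)
open import Data.Product using (∃; _,_)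
open import Data.Sum using (inj₁; inj₂)
open import Data.Sum.Properties using (≡-dec)
open import Data.Unit using (tt)
open import Data.Fin as Fin using (Fin)
open import Relation.Nullary using (yes; no)
open import Relation.Binary.PropositionalEquality using (_≡_; _≢_; refl; ≢-sym)
open import Relation.Binary.Definitions using (DecidableEquality)
open import Algebra.Bundles using (Group; AbelianGroup)
import Algebra.Properties.Group as GroupProperties
import Relation.Binary.Reasoning.Setoid as SetoidReasoning

module _ {m n : ℕ} where

  _≟_ : DecidableEquality (Vertex m n)
  _≟_ = ≡-dec Fin._≟_ Fin._≟_

  Adj⇒≢ : {x y : Vertex m n} → Adj x y → x ≢ y
  Adj⇒≢ {inj₁ _} {inj₂ _} _ ()
  Adj⇒≢ {inj₂ _} {inj₁ _} _ ()

  square-isCycle : {x y z w : Vertex m n} → Adj x y → Adj y z → Adj z w → Adj w x →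
                   x ≢ z → y ≢ w → IsCycle (x ∷ y ∷ z ∷ w ∷ [])
  square-isCycle xy yz zw wx x≢z y≢w =
    s≤s (s≤s (s≤s z≤n)) ,
    (Adj⇒≢ xy ∷ x≢z ∷ ≢-sym (Adj⇒≢ wx) ∷ []) ∷
    (Adj⇒≢ yz ∷ y≢w ∷ []) ∷ (Adj⇒≢ zw ∷ []) ∷ [] ∷ [] ,
    xy ∷ yz ∷ zw ∷ wx ∷ [-]

module GroupWords {c ℓ} (G : Group c ℓ) where
  open Group G
  open GroupProperties G using (inverseˡ-unique)
  open SetoidReasoning setoid

  word₄-assoc : ∀ g₁ g₂ g₃ g₄ → g₁ ∙ (g₂ ∙ (g₃ ∙ (g₄ ∙ ε))) ≈ ((g₁ ∙ g₂) ∙ g₃) ∙ g₄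
  word₄-assoc g₁ g₂ g₃ g₄ = begin
    g₁ ∙ (g₂ ∙ (g₃ ∙ (g₄ ∙ ε))) ≈⟨ ∙-congˡ (∙-congˡ (∙-congˡ (identityʳ g₄))) ⟩
    g₁ ∙ (g₂ ∙ (g₃ ∙ g₄))       ≈⟨ assoc g₁ g₂ (g₃ ∙ g₄) ⟨
    (g₁ ∙ g₂) ∙ (g₃ ∙ g₄)       ≈⟨ assoc (g₁ ∙ g₂) g₃ g₄ ⟨
    ((g₁ ∙ g₂) ∙ g₃) ∙ g₄       ∎

  word₄≈ε⇒ : ∀ g₁ g₂ g₃ g₄ → g₁ ∙ (g₂ ∙ (g₃ ∙ (g₄ ∙ ε))) ≈ ε → (g₁ ∙ g₂) ∙ g₃ ≈ g₄ ⁻¹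
  word₄≈ε⇒ g₁ g₂ g₃ g₄ eq = inverseˡ-unique _ g₄ (trans (sym (word₄-assoc g₁ g₂ g₃ g₄)) eq)

  word₄≈ε⇐ : ∀ g₁ g₂ g₃ g₄ → (g₁ ∙ g₂) ∙ g₃ ≈ g₄ ⁻¹ → g₁ ∙ (g₂ ∙ (g₃ ∙ (g₄ ∙ ε))) ≈ ε
  word₄≈ε⇐ g₁ g₂ g₃ g₄ eq = begin
    g₁ ∙ (g₂ ∙ (g₃ ∙ (g₄ ∙ ε))) ≈⟨ word₄-assoc g₁ g₂ g₃ g₄ ⟩
    ((g₁ ∙ g₂) ∙ g₃) ∙ g₄       ≈⟨ ∙-congʳ eq ⟩
    g₄ ⁻¹ ∙ g₄                  ≈⟨ inverseˡ g₄ ⟩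
    ε                           ∎

  word₄-cancel-adjacent : ∀ {g₁ g₂ g₃ g₄} → g₁ ∙ g₂ ≈ ε → g₃ ∙ g₄ ≈ ε →
                          g₁ ∙ (g₂ ∙ (g₃ ∙ (g₄ ∙ ε))) ≈ ε
  word₄-cancel-adjacent {g₁} {g₂} {g₃} {g₄} e₁₂ e₃₄ = word₄≈ε⇐ g₁ g₂ g₃ g₄ (begin
    (g₁ ∙ g₂) ∙ g₃ ≈⟨ ∙-congʳ e₁₂ ⟩
    ε ∙ g₃         ≈⟨ identityˡ g₃ ⟩
    g₃             ≈⟨ inverseˡ-unique g₃ g₄ e₃₄ ⟩
    g₄ ⁻¹          ∎)

  word₄-cancel-nested : ∀ {g₁ g₂ g₃ g₄} → g₂ ∙ g₃ ≈ ε → g₁ ∙ g₄ ≈ ε →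
                        g₁ ∙ (g₂ ∙ (g₃ ∙ (g₄ ∙ ε))) ≈ ε
  word₄-cancel-nested {g₁} {g₂} {g₃} {g₄} e₂₃ e₁₄ = word₄≈ε⇐ g₁ g₂ g₃ g₄ (begin
    (g₁ ∙ g₂) ∙ g₃ ≈⟨ assoc g₁ g₂ g₃ ⟩
    g₁ ∙ (g₂ ∙ g₃) ≈⟨ ∙-congˡ e₂₃ ⟩
    g₁ ∙ ε         ≈⟨ identityʳ g₁ ⟩
    g₁             ≈⟨ inverseˡ-unique g₁ g₄ e₁₄ ⟩
    g₄ ⁻¹          ∎)

module _ {c ℓ} (T : AbelianGroup c ℓ) where
  open AbelianGroup T hiding (refl)
  open GainGraph T
  open GroupProperties group using (∙-cancelˡ; ⁻¹-involutive; x≈z//y; //-rightDividesˡ)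
  open GroupWords group
  open SetoidReasoning setoid

  edgeGain-cancel : ∀ {m n} (φ : GainFn m n) x y → edgeGain φ x y ∙ edgeGain φ y x ≈ ε
  edgeGain-cancel φ (inj₁ a) (inj₂ b) = inverseʳ (φ a b)
  edgeGain-cancel φ (inj₂ b) (inj₁ a) = inverseˡ (φ a b)
  edgeGain-cancel φ (inj₁ _) (inj₁ _) = identityˡ ε
  edgeGain-cancel φ (inj₂ _) (inj₂ _) = identityˡ ε

  module _ {m n : ℕ} (φ : GainFn m n) where

    IsPotential : (Vertex m n → Carrier) → Set ℓ
    IsPotential p = ∀ a b → p (inj₁ a) ∙ φ a b ≈ p (inj₂ b)

    FourCyclesBalancedAt : Vertex m n → Set ℓ
    FourCyclesBalancedAt v = (cs : List (Vertex m n)) → IsCycle cs → length cs ≡ 4 → v ∈ cs →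
                             cycleGain φ cs ≈ ε

    module _ {p : Vertex m n → Carrier} (potential : IsPotential p) where

      potential-edge : ∀ x y → Adj x y → p x ∙ edgeGain φ x y ≈ p y
      potential-edge (inj₁ a) (inj₂ b) _ = potential a b
      potential-edge (inj₂ b) (inj₁ a) _ = sym (x≈z//y _ _ _ (potential a b))

      potential-walk : ∀ x xs z → Linked Adj (x ∷ xs ++ [ z ]) →
                       p x ∙ walkGain φ (x ∷ xs ++ [ z ]) ≈ p z
      potential-walk x [] z (xz ∷ _) = begin
        p x ∙ (edgeGain φ x z ∙ ε) ≈⟨ ∙-congˡ (identityʳ _) ⟩
        p x ∙ edgeGain φ x z       ≈⟨ potential-edge x z xz ⟩
        p z                        ∎
      potential-walk x (y ∷ ys) z (xy ∷ rest) = begin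
        p x ∙ (edgeGain φ x y ∙ walkGain φ (y ∷ ys ++ [ z ])) ≈⟨ assoc _ _ _ ⟨
        (p x ∙ edgeGain φ x y) ∙ walkGain φ (y ∷ ys ++ [ z ]) ≈⟨ ∙-congʳ (potential-edge x y xy) ⟩
        p y ∙ walkGain φ (y ∷ ys ++ [ z ])                    ≈⟨ potential-walk y ys z rest ⟩
        p z                                                    ∎

      potential⇒balanced : Balanced φ
      potential⇒balanced (x ∷ xs) (_ , _ , closed) =
        ∙-cancelˡ (p x) _ _ (trans (potential-walk x xs x closed) (sym (identityʳ (p x))))

    closedWalk₄-gain : ∀ {v y z w} → FourCyclesBalancedAt v →
                       Adj v y → Adj y z → Adj z w → Adj w v →
                       cycleGain φ (v ∷ y ∷ z ∷ w ∷ []) ≈ ε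
    closedWalk₄-gain {v} {y} {z} {w} balanced₄ vy yz zw wv with v ≟ z | y ≟ w
    ... | yes refl | _ =
      word₄-cancel-adjacent (edgeGain-cancel φ v y) (edgeGain-cancel φ v w)
    ... | no _ | yes refl =
      word₄-cancel-nested (edgeGain-cancel φ y z) (edgeGain-cancel φ v y)
    ... | no v≢z | no y≢w =
      balanced₄ _ (square-isCycle vy yz zw wv v≢z y≢w) refl (here refl)

    rootedAtLeft : Fin m → Fin n → Vertex m n → Carrier
    rootedAtLeft a₀ b₀ (inj₁ a) = φ a₀ b₀ ∙ φ a b₀ ⁻¹
    rootedAtLeft a₀ b₀ (inj₂ b) = φ a₀ b

    rootedAtLeft-isPotential : ∀ {a₀} b₀ → FourCyclesBalancedAt (inj₁ a₀) →
                               IsPotential (rootedAtLeft a₀ b₀)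
    rootedAtLeft-isPotential {a₀} b₀ balanced₄ a b =
      trans (word₄≈ε⇒ _ _ _ _ (closedWalk₄-gain {y = inj₂ b₀} {inj₁ a} {inj₂ b} balanced₄ tt tt tt tt))
            (⁻¹-involutive (φ a₀ b))

    rootedAtRight : Fin m → Fin n → Vertex m n → Carrier
    rootedAtRight a₀ b₀ (inj₁ a) = φ a b₀ ⁻¹
    rootedAtRight a₀ b₀ (inj₂ b) = φ a₀ b₀ ⁻¹ ∙ φ a₀ b

    rootedAtRight-isPotential : ∀ a₀ {b₀} → FourCyclesBalancedAt (inj₂ b₀) →
                                IsPotential (rootedAtRight a₀ b₀)
    rootedAtRight-isPotential a₀ {b₀} balanced₄ a b =
      trans (∙-congʳ (sym (word₄≈ε⇒ _ _ _ _
              (closedWalk₄-gain {y = inj₁ a₀} {inj₂ b} {inj₁ a} balanced₄ tt tt tt tt))))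
            (//-rightDividesˡ (φ a b) _)

  fourCyclesBalancedAt⇒potential : ∀ m n (φ : GainFn m n) v → FourCyclesBalancedAt φ v →
                                   ∃ (IsPotential φ)
  fourCyclesBalancedAt⇒potential m zero    φ (inj₁ a₀) _ = (λ _ → ε) , λ _ ()
  fourCyclesBalancedAt⇒potential m (suc n) φ (inj₁ a₀) balanced₄ =
    rootedAtLeft φ a₀ Fin.zero , rootedAtLeft-isPotential φ Fin.zero balanced₄
  fourCyclesBalancedAt⇒potential zero    n φ (inj₂ b₀) _ = (λ _ → ε) , λ ()
  fourCyclesBalancedAt⇒potential (suc m) n φ (inj₂ b₀) balanced₄ =
    rootedAtRight φ Fin.zero b₀ , rootedAtRight-isPotential φ Fin.zero balanced₄

lemma4p2 : ∀ {c ℓ} (T : AbelianGroup c ℓ) (m n : ℕ) (φ : GainGraph.GainFn T m n) →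
    ∃ (λ (v : Vertex m n) → (cs : List (Vertex m n)) → IsCycle cs → length cs ≡ 4 → v ∈ cs →
      AbelianGroup._≈_ T (GainGraph.cycleGain T φ cs) (AbelianGroup.ε T)) →
    GainGraph.Balanced T φ
lemma4p2 T m n φ (v , balanced₄) =
  let p , potential = fourCyclesBalancedAt⇒potential T m n φ v balanced₄
  in  potential⇒balanced T φ {p} potential
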